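{- Let $\mathscr{D}$ be a commutative variety of algebras, $X,Y$ objects of $\mathscr{D}$, and $L:X^{\circledast}\to Y$ a morphism of $\mathscr{D}$. Then the syntactic congruence \[E=\{(u,v)\in|X^{\circledast}|\times|X^{\circledast}| \mid \forall x,y\in|X^{\circledast}|:\ L(x\bullet u\bullet y)=L(x\bullet v\bullet y)\},\] with its two projections $l,r:E\to X^{\circledast}$, is a $\mathscr{D}$-monoid congruence on $X^{\circledast}$.
   Context: $\mathscr{D}$ commutative variety: the homomorphisms $A\to B$ form a subalgebra $[A,B]$ of $B^{|A|}$; $\mathscr{D}$ has tensor products representing bimorphisms and unit $I=\Psi 1$. A $\mathscr{D}$-monoid is an algebra with a monoid structure whose multiplication $\bullet$ is a bimorphism; $\mathscr{D}$-monoid morphisms are homomorphisms preserving the monoid structure. $X^{\circledast}$ is the free $\mathscr{D}$-monoid on $X$. $E$ is a subalgebra of $X^{\circledast}\times X^{\circledast}$ (canonically an object of $\mathscr{D}$). A $\mathscr{D}$-monoid congruence on a $\mathscr{D}$-monoid $M$ is a $\mathscr{D}$-submonoid of $M\times M$ which is reflexive, symmetric and transitive as a relation. -}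

module Defs where

open import Data.Nat using (ℕ)
open import Data.Fin using (Fin)
open import Data.Vec using (Vec; []; _∷_; map)
open import Data.Vec.Relation.Unary.All using (All)
open import Data.Product using (Σ; _×_; _,_; proj₁; proj₂)
open import Relation.Binary.PropositionalEquality using (_≡_)
open import Relation.Binary.Structures using (IsEquivalence)

record Signature : Set₁ where
  field
    Op    : Set
    arity : Op → ℕ
open Signature public

data Term (S : Signature) (n : ℕ) : Set where
  var : Fin n → Term S n
  op  : (f : Op S) → Vec (Term S n) (arity S f) → Term S n

record Algebra (S : Signature) : Set₁ where
  field
    Carrier : Set
    ⟦_⟧     : (f : Op S) → Vec Carrier (arity S f) → Carrier
open Algebra public

module _ {S : Signature} (A : Algebra S) {n : ℕ} (ρ : Fin n → Carrier A) where
  mutual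
    eval : Term S n → Carrier A
    eval (var i)  = ρ i
    eval (op f ts) = ⟦ A ⟧ f (evalVec ts)

    evalVec : ∀ {k} → Vec (Term S n) k → Vec (Carrier A) k
    evalVec []       = []
    evalVec (t ∷ ts) = eval t ∷ evalVec ts

record Variety : Set₁ where
  field
    sig    : Signature
    Eqn    : Set
    eqVars : Eqn → ℕ
    lhs    : (e : Eqn) → Term sig (eqVars e)
    rhs    : (e : Eqn) → Term sig (eqVars e)
open Variety public

Satisfies : (V : Variety) → Algebra (sig V) → Set
Satisfies V A = ∀ (e : Eqn V) (ρ : Fin (eqVars V e) → Carrier A) →
  eval A ρ (lhs V e) ≡ eval A ρ (rhs V e)

record DAlg (V : Variety) : Set₁ where
  field
    alg : Algebra (sig V)
    sat : Satisfies V alg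
open DAlg public

IsHom : {S : Signature} (A B : Algebra S) → (Carrier A → Carrier B) → Set
IsHom {S} A B h = ∀ (f : Op S) (xs : Vec (Carrier A) (arity S f)) →
  h (⟦ A ⟧ f xs) ≡ ⟦ B ⟧ f (map h xs)

IsSubalgebra : {S : Signature} (A : Algebra S) → (Carrier A → Set) → Set
IsSubalgebra {S} A P = ∀ (f : Op S) (xs : Vec (Carrier A) (arity S f)) →
  All P xs → P (⟦ A ⟧ f xs)

Power : {S : Signature} → Set → Algebra S → Algebra S
Power {S} I B = record
  { Carrier = I → Carrier B
  ; ⟦_⟧ = λ f gs i → ⟦ B ⟧ f (map (λ g → g i) gs) }

_×ₐ_ : {S : Signature} → Algebra S → Algebra S → Algebra S
A ×ₐ B = record
  { Carrier = Carrier A × Carrier B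
  ; ⟦_⟧ = λ f ps → ⟦ A ⟧ f (map proj₁ ps) , ⟦ B ⟧ f (map proj₂ ps) }

Commutative : Variety → Set₁
Commutative V = ∀ (A B : DAlg V) →
  IsSubalgebra (Power (Carrier (alg A)) (alg B)) (IsHom (alg A) (alg B))

record DMonoid (V : Variety) : Set₁ where
  field
    dalg  : DAlg V
  A : Algebra (sig V)
  A = alg dalg
  |M| : Set
  |M| = Carrier A
  field
    ε     : |M|
    _∙_   : |M| → |M| → |M|
    assoc : ∀ a b c → (a ∙ b) ∙ c ≡ a ∙ (b ∙ c)
    idˡ   : ∀ a → ε ∙ a ≡ a
    idʳ   : ∀ a → a ∙ ε ≡ a
    bimorˡ : ∀ a → IsHom A A (λ b → a ∙ b)
    bimorʳ : ∀ b → IsHom A A (λ a → a ∙ b)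

module _ {V : Variety} where
  open DMonoid

  IsDMonoidMorphism : (M N : DMonoid V) → (|M| M → |M| N) → Set
  IsDMonoidMorphism M N h =
    IsHom (A M) (A N) h × h (ε M) ≡ ε N ×
    (∀ a b → h (_∙_ M a b) ≡ _∙_ N (h a) (h b))

  IsFreeDMonoid : (X : DAlg V) (M : DMonoid V) → (Carrier (alg X) → |M| M) → Set₁
  IsFreeDMonoid X M η =
    IsHom (alg X) (A M) η ×
    (∀ (N : DMonoid V) (f : Carrier (alg X) → |M| N) → IsHom (alg X) (A N) f →
      Σ (|M| M → |M| N) λ g →
        (IsDMonoidMorphism M N g × (∀ x → g (η x) ≡ f x)) ×
        (∀ (g' : |M| M → |M| N) → IsDMonoidMorphism M N g' →
           (∀ x → g' (η x) ≡ f x) → ∀ m → g' m ≡ g m))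

  IsSubmonoidOfSquare : (M : DMonoid V) → (|M| M → |M| M → Set) → Set
  IsSubmonoidOfSquare M R =
    IsSubalgebra (A M ×ₐ A M) (λ p → R (proj₁ p) (proj₂ p)) ×
    R (ε M) (ε M) ×
    (∀ {a b c d} → R a b → R c d → R (_∙_ M a c) (_∙_ M b d))

  IsDMonoidCongruence : (M : DMonoid V) → (|M| M → |M| M → Set) → Set
  IsDMonoidCongruence M R = IsSubmonoidOfSquare M R × IsEquivalence R

  SyntacticCongruence : (M : DMonoid V) (Y : DAlg V) →
    (|M| M → Carrier (alg Y)) → |M| M → |M| M → Set
  SyntacticCongruence M Y L u v =
    ∀ (x y : |M| M) → L (_∙_ M (_∙_ M x u) y) ≡ L (_∙_ M (_∙_ M x v) y)

-- Each context u ↦ L ((x ∙ u) ∙ y) is a homomorphism, since ∙ is a bimorphism and L is a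
-- homomorphism; the syntactic congruence is the intersection of the kernels of these maps,
-- hence a subalgebra of X⊛ × X⊛ and an equivalence. Compatibility with ∙ is associativity:
-- a context of a ∙ c is a context of a, and a context of b ∙ c is a context of c.
module Submission where

open import Defs
open import Data.Vec using (Vec; _∷_; map)
open import Data.Vec.Properties using (map-∘)
open import Data.Vec.Relation.Unary.All as All using (All; []; _∷_)
open import Data.Product using (_,_; proj₁; proj₂)
open import Function using (_∘_)
open import Relation.Binary.PropositionalEquality
open import Relation.Binary.Structures using (IsEquivalence)

map-cong-All : ∀ {A B : Set} {P : A → Set} {f g : A → B} →
  (∀ {a} → P a → f a ≡ g a) → ∀ {n} {xs : Vec A n} → All P xs → map f xs ≡ map g xs
map-cong-All f≡g []         = refl
map-cong-All f≡g (pa ∷ pas) = cong₂ _∷_ (f≡g pa) (map-cong-All f≡g pas)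

module _ {S : Signature} where

  IsHom-∘ : (A B C : Algebra S) {g : Carrier B → Carrier C} {h : Carrier A → Carrier B} →
    IsHom B C g → IsHom A B h → IsHom A C (g ∘ h)
  IsHom-∘ A B C {g} {h} g-hom h-hom f xs = begin
    g (h (⟦ A ⟧ f xs))          ≡⟨ cong g (h-hom f xs) ⟩
    g (⟦ B ⟧ f (map h xs))      ≡⟨ g-hom f (map h xs) ⟩
    ⟦ C ⟧ f (map g (map h xs))  ≡⟨ cong (⟦ C ⟧ f) (map-∘ g h xs) ⟨
    ⟦ C ⟧ f (map (g ∘ h) xs)    ∎
    where open ≡-Reasoning

  kernel-isSubalgebra : (A B : Algebra S) {h : Carrier A → Carrier B} → IsHom A B h →
    IsSubalgebra (A ×ₐ A) (λ p → h (proj₁ p) ≡ h (proj₂ p))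
  kernel-isSubalgebra A B {h} h-hom f ps same = begin
    h (⟦ A ⟧ f (map proj₁ ps))        ≡⟨ h-hom f (map proj₁ ps) ⟩
    ⟦ B ⟧ f (map h (map proj₁ ps))    ≡⟨ cong (⟦ B ⟧ f) (map-∘ h proj₁ ps) ⟨
    ⟦ B ⟧ f (map (h ∘ proj₁) ps)      ≡⟨ cong (⟦ B ⟧ f) (map-cong-All (λ eq → eq) same) ⟩
    ⟦ B ⟧ f (map (h ∘ proj₂) ps)      ≡⟨ cong (⟦ B ⟧ f) (map-∘ h proj₂ ps) ⟩
    ⟦ B ⟧ f (map h (map proj₂ ps))    ≡⟨ h-hom f (map proj₂ ps) ⟨
    h (⟦ A ⟧ f (map proj₂ ps))        ∎
    where open ≡-Reasoning

module _ {V : Variety} (M : DMonoid V) (Y : DAlg V)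
         (L : DMonoid.|M| M → Carrier (alg Y)) where
  open DMonoid M

  private
    R : |M| → |M| → Set
    R = SyntacticCongruence M Y L

  syntactic-isEquivalence : IsEquivalence R
  syntactic-isEquivalence = record
    { refl  = λ x y → refl
    ; sym   = λ u~v x y → sym (u~v x y)
    ; trans = λ u~v v~w x y → trans (u~v x y) (v~w x y)
    }

  syntactic-compatible : ∀ {a b c d} → R a b → R c d → R (a ∙ c) (b ∙ d)
  syntactic-compatible {a} {b} {c} {d} a~b c~d x y = begin
    L ((x ∙ (a ∙ c)) ∙ y)   ≡⟨ cong (λ z → L (z ∙ y)) (assoc x a c) ⟨
    L (((x ∙ a) ∙ c) ∙ y)   ≡⟨ cong L (assoc (x ∙ a) c y) ⟩
    L ((x ∙ a) ∙ (c ∙ y))   ≡⟨ a~b x (c ∙ y) ⟩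
    L ((x ∙ b) ∙ (c ∙ y))   ≡⟨ cong L (assoc (x ∙ b) c y) ⟨
    L (((x ∙ b) ∙ c) ∙ y)   ≡⟨ c~d (x ∙ b) y ⟩
    L (((x ∙ b) ∙ d) ∙ y)   ≡⟨ cong (λ z → L (z ∙ y)) (assoc x b d) ⟩
    L ((x ∙ (b ∙ d)) ∙ y)   ∎
    where open ≡-Reasoning

  module _ (L-hom : IsHom A (alg Y) L) where

    context-isHom : ∀ x y → IsHom A (alg Y) (λ u → L ((x ∙ u) ∙ y))
    context-isHom x y = IsHom-∘ A A (alg Y) L-hom (IsHom-∘ A A A (bimorʳ y) (bimorˡ x))

    syntactic-isSubalgebra : IsSubalgebra (A ×ₐ A) (λ p → R (proj₁ p) (proj₂ p))
    syntactic-isSubalgebra f ps related x y =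
      kernel-isSubalgebra A (alg Y) (context-isHom x y) f ps (All.map (λ u~v → u~v x y) related)

    syntactic-isDMonoidCongruence : IsDMonoidCongruence M R
    syntactic-isDMonoidCongruence =
      (syntactic-isSubalgebra , (λ x y → refl) , syntactic-compatible) ,
      syntactic-isEquivalence

lemma38 : (V : Variety) → Commutative V → (X Y : DAlg V) →
    (X⊛ : DMonoid V) (η : Carrier (alg X) → DMonoid.|M| X⊛) → IsFreeDMonoid X X⊛ η →
    (L : DMonoid.|M| X⊛ → Carrier (alg Y)) → IsHom (DMonoid.A X⊛) (alg Y) L →
    IsDMonoidCongruence X⊛ (SyntacticCongruence X⊛ Y L)
lemma38 V _ X Y X⊛ η _ L L-hom = syntactic-isDMonoidCongruence X⊛ Y L L-hom
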